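{- Let $\mathcal{B}=\langle B,\wedge,\vee,\neg,0,1\rangle$ be a Boolean algebra and $\mathbf{G},\mathbf{H},\mathbf{F},\mathbf{P}$ unary operators on $B$. Then $\langle\mathcal{B},\mathbf{G},\mathbf{H},\mathbf{F},\mathbf{P}\rangle$ is a tense algebra if and only if $\langle B,\wedge,\vee,0,1,\mathbf{G},\mathbf{H},\mathbf{F},\mathbf{P}\rangle$ is a $\mathbf{tDL}$-algebra.
   Context: A $\mathbf{tDL}$-algebra is a bounded distributive lattice $\langle A,\wedge,\vee,0,1\rangle$ with unary operators $\mathbf{G},\mathbf{H},\mathbf{F},\mathbf{P}$ such that for all $x,y$: (t1) $\mathbf{G}1=\mathbf{H}1=1$; (t2) $\mathbf{G}(x\wedge y)=\mathbf{G}x\wedge\mathbf{G}y$, $\mathbf{H}(x\wedge y)=\mathbf{H}x\wedge\mathbf{H}y$; (t3) $x\le\mathbf{G}\mathbf{P}x$, $x\le\mathbf{H}\mathbf{F}x$; (t4) $\mathbf{G}(x\vee y)\le\mathbf{G}x\vee\mathbf{F}y$, $\mathbf{H}(x\vee y)\le\mathbf{H}x\vee\mathbf{P}y$; (t5) $\mathbf{F}0=\mathbf{P}0=0$; (t6) $\mathbf{F}(x\vee y)=\mathbf{F}x\vee\mathbf{F}y$, $\mathbf{P}(x\vee y)=\mathbf{P}x\vee\mathbf{P}y$; (t7) $\mathbf{P}\mathbf{G}x\le x$, $\mathbf{F}\mathbf{H}x\le x$; (t8) $\mathbf{G}x\wedge\mathbf{F}y\le\mathbf{F}(x\wedge y)$,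 $\mathbf{H}x\wedge\mathbf{P}y\le\mathbf{P}(x\wedge y)$. A tense algebra, written in the signature with all four operators, is a Boolean algebra with unary operators $\mathbf{G},\mathbf{H},\mathbf{F},\mathbf{P}$ such that $\mathbf{G},\mathbf{H}$ satisfy (t1), (t2), (t3) and $\mathbf{F}x=\neg\mathbf{G}\neg x$, $\mathbf{P}x=\neg\mathbf{H}\neg x$ for all $x$. -}

module Defs where

open import Level using (Level; _⊔_)
open import Data.Product using (_×_)
open import Algebra.Core using (Op₁)
open import Algebra.Definitions using (Congruent₁)
open import Algebra.Lattice.Bundles using (BooleanAlgebra)

-- Throughout, B is a Boolean algebra (stdlib bundle, equality is the
-- setoid equality _≈_), and G H F P are unary operators on its carrier.
-- "unary operator" on a setoid-based algebra means a function respecting _≈_.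

module _ {c ℓ : Level} (B : BooleanAlgebra c ℓ) where
  open BooleanAlgebra B

  _≤_ : Carrier → Carrier → Set ℓ
  x ≤ y = (x ∧ y) ≈ x

  record Operators : Set (c ⊔ ℓ) where
    field
      G H F P : Op₁ Carrier
      G-cong : Congruent₁ _≈_ G
      H-cong : Congruent₁ _≈_ H
      F-cong : Congruent₁ _≈_ F
      P-cong : Congruent₁ _≈_ P

  -- ⟨B,∧,∨,0,1,G,H,F,P⟩ is a tDL-algebra (its bounded distributive
  -- lattice reduct being that of B; 0 = ⊥, 1 = ⊤): axioms (t1)-(t8).
  record IsTDL (O : Operators) : Set (c ⊔ ℓ) where
    open Operators O
    field
      t1G : G ⊤ ≈ ⊤
      t1H : H ⊤ ≈ ⊤
      t2G : ∀ x y → G (x ∧ y) ≈ (G x ∧ G y)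
      t2H : ∀ x y → H (x ∧ y) ≈ (H x ∧ H y)
      t3G : ∀ x → x ≤ G (P x)
      t3H : ∀ x → x ≤ H (F x)
      t4G : ∀ x y → G (x ∨ y) ≤ (G x ∨ F y)
      t4H : ∀ x y → H (x ∨ y) ≤ (H x ∨ P y)
      t5F : F ⊥ ≈ ⊥
      t5P : P ⊥ ≈ ⊥
      t6F : ∀ x y → F (x ∨ y) ≈ (F x ∨ F y)
      t6P : ∀ x y → P (x ∨ y) ≈ (P x ∨ P y)
      t7G : ∀ x → P (G x) ≤ x
      t7H : ∀ x → F (H x) ≤ x
      t8F : ∀ x y → (G x ∧ F y) ≤ F (x ∧ y)
      t8P : ∀ x y → (H x ∧ P y) ≤ P (x ∧ y)

  record IsTense (O : Operators) : Set (c ⊔ ℓ) where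
    open Operators O
    field
      t1G : G ⊤ ≈ ⊤
      t1H : H ⊤ ≈ ⊤
      t2G : ∀ x y → G (x ∧ y) ≈ (G x ∧ G y)
      t2H : ∀ x y → H (x ∧ y) ≈ (H x ∧ H y)
      t3G : ∀ x → x ≤ G (P x)
      t3H : ∀ x → x ≤ H (F x)
      F-def : ∀ x → F x ≈ (¬ G (¬ x))
      P-def : ∀ x → P x ≈ (¬ H (¬ x))

{-# OPTIONS --safe #-}
module Submission where

-- A tense algebra has F = ¬G¬ and P = ¬H¬ by fiat; the axioms (t4)-(t8) then follow from G and H
-- preserving meets, with (t7) being the contrapositive of (t3) for the other pair.  Conversely, in a
-- tDL-algebra (t1), (t4), (t5) and (t8) make G¬x and Fx complementary: G¬x ∨ Fx ≥ G(¬x ∨ x) = ⊤ and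
-- G¬x ∧ Fx ≤ F(¬x ∧ x) = ⊥, so Fx = ¬G¬x by uniqueness of complements (likewise for H and P).

open import Defs using (Operators; IsTDL; IsTense)
open import Level using (Level)
open import Data.Product using (_×_; _,_)
open import Algebra.Core using (Op₁)
open import Algebra.Definitions using (Congruent₁)
open import Algebra.Lattice.Bundles using (BooleanAlgebra)
import Algebra.Lattice.Properties.BooleanAlgebra as BooleanAlgebraProperties
import Relation.Binary.Reasoning.Setoid as SetoidReasoning

module _ {c ℓ : Level} (B : BooleanAlgebra c ℓ) where
  open BooleanAlgebra B
  open BooleanAlgebraProperties B
  open SetoidReasoning setoid

  infix 4 _≤_
  _≤_ : Carrier → Carrier → Set ℓ
  _≤_ = Defs._≤_ B

  ≤-respˡ-≈ : ∀ {x x′ y} → x ≈ x′ → x ≤ y → x′ ≤ y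
  ≤-respˡ-≈ {x} {x′} {y} x≈x′ x≤y = begin
    x′ ∧ y ≈⟨ ∧-congʳ x≈x′ ⟨
    x ∧ y  ≈⟨ x≤y ⟩
    x      ≈⟨ x≈x′ ⟩
    x′     ∎

  ≤-respʳ-≈ : ∀ {x y y′} → y ≈ y′ → x ≤ y → x ≤ y′
  ≤-respʳ-≈ y≈y′ x≤y = trans (∧-congˡ (sym y≈y′)) x≤y

  ≤-antisym : ∀ {x y} → x ≤ y → y ≤ x → x ≈ y
  ≤-antisym {x} {y} x≤y y≤x = begin
    x     ≈⟨ x≤y ⟨
    x ∧ y ≈⟨ ∧-comm x y ⟩
    y ∧ x ≈⟨ y≤x ⟩
    y     ∎

  x≤⊥⇒x≈⊥ : ∀ {x} → x ≤ ⊥ → x ≈ ⊥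
  x≤⊥⇒x≈⊥ {x} x≤⊥ = trans (sym x≤⊥) (∧-zeroʳ x)

  ⊤≤x⇒x≈⊤ : ∀ {x} → ⊤ ≤ x → x ≈ ⊤
  ⊤≤x⇒x≈⊤ {x} ⊤≤x = trans (sym (∧-identityˡ x)) ⊤≤x

  x∧¬y≈⊥⇒x≤y : ∀ {x y} → x ∧ ¬ y ≈ ⊥ → x ≤ y
  x∧¬y≈⊥⇒x≤y {x} {y} x∧¬y≈⊥ = sym (begin
    x               ≈⟨ ∧-identityʳ x ⟨
    x ∧ ⊤           ≈⟨ ∧-congˡ (∨-complementʳ y) ⟨
    x ∧ (y ∨ ¬ y)   ≈⟨ ∧-distribˡ-∨ x y (¬ y) ⟩
    x ∧ y ∨ x ∧ ¬ y ≈⟨ ∨-congˡ x∧¬y≈⊥ ⟩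
    x ∧ y ∨ ⊥       ≈⟨ ∨-identityʳ (x ∧ y) ⟩
    x ∧ y           ∎)

  x≤y⇒x∧¬y≈⊥ : ∀ {x y} → x ≤ y → x ∧ ¬ y ≈ ⊥
  x≤y⇒x∧¬y≈⊥ {x} {y} x≤y = begin
    x ∧ ¬ y       ≈⟨ ∧-congʳ x≤y ⟨
    (x ∧ y) ∧ ¬ y ≈⟨ ∧-assoc x y (¬ y) ⟩
    x ∧ (y ∧ ¬ y) ≈⟨ ∧-congˡ (∧-complementʳ y) ⟩
    x ∧ ⊥         ≈⟨ ∧-zeroʳ x ⟩
    ⊥             ∎

  ¬-antitone : ∀ {x y} → x ≤ y → ¬ y ≤ ¬ x
  ¬-antitone {x} {y} x≤y = x∧¬y≈⊥⇒x≤y (begin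
    ¬ y ∧ ¬ ¬ x ≈⟨ ∧-congˡ (¬-involutive x) ⟩
    ¬ y ∧ x     ≈⟨ ∧-comm (¬ y) x ⟩
    x ∧ ¬ y     ≈⟨ x≤y⇒x∧¬y≈⊥ x≤y ⟩
    ⊥           ∎)

  ¬-unique : ∀ {x y} → x ∧ y ≈ ⊥ → x ∨ y ≈ ⊤ → ¬ x ≈ y
  ¬-unique {x} {y} x∧y≈⊥ x∨y≈⊤ = ≤-antisym ¬x≤y y≤¬x
    where
    ¬x≤y : ¬ x ≤ y
    ¬x≤y = x∧¬y≈⊥⇒x≤y (begin
      ¬ x ∧ ¬ y ≈⟨ deMorgan₂ x y ⟨
      ¬ (x ∨ y) ≈⟨ ¬-cong x∨y≈⊤ ⟩
      ¬ ⊤       ≈⟨ ¬⊤≈⊥ ⟩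
      ⊥         ∎)
    y≤¬x : y ≤ ¬ x
    y≤¬x = x∧¬y≈⊥⇒x≤y (begin
      y ∧ ¬ ¬ x ≈⟨ ∧-congˡ (¬-involutive x) ⟩
      y ∧ x     ≈⟨ ∧-comm y x ⟩
      x ∧ y     ≈⟨ x∧y≈⊥ ⟩
      ⊥         ∎)

  ∧-swapʳ : ∀ x y z → (x ∧ y) ∧ z ≈ (x ∧ z) ∧ y
  ∧-swapʳ x y z = begin
    (x ∧ y) ∧ z ≈⟨ ∧-assoc x y z ⟩
    x ∧ (y ∧ z) ≈⟨ ∧-congˡ (∧-comm y z) ⟩
    x ∧ (z ∧ y) ≈⟨ ∧-assoc x z y ⟨
    (x ∧ z) ∧ y ∎

  ∧-≤⇒≤-∨¬ : ∀ {x y z} → x ∧ y ≤ z → x ≤ z ∨ ¬ y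
  ∧-≤⇒≤-∨¬ {x} {y} {z} x∧y≤z = x∧¬y≈⊥⇒x≤y (begin
    x ∧ ¬ (z ∨ ¬ y)   ≈⟨ ∧-congˡ (deMorgan₂ z (¬ y)) ⟩
    x ∧ (¬ z ∧ ¬ ¬ y) ≈⟨ ∧-congˡ (∧-congˡ (¬-involutive y)) ⟩
    x ∧ (¬ z ∧ y)     ≈⟨ ∧-assoc x (¬ z) y ⟨
    (x ∧ ¬ z) ∧ y     ≈⟨ ∧-swapʳ x (¬ z) y ⟩
    (x ∧ y) ∧ ¬ z     ≈⟨ x≤y⇒x∧¬y≈⊥ x∧y≤z ⟩
    ⊥                 ∎)

  ∧-≤⇒∧¬-≤¬ : ∀ {x y z} → x ∧ z ≤ y → x ∧ ¬ y ≤ ¬ z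
  ∧-≤⇒∧¬-≤¬ {x} {y} {z} x∧z≤y = x∧¬y≈⊥⇒x≤y (begin
    (x ∧ ¬ y) ∧ ¬ ¬ z ≈⟨ ∧-congˡ (¬-involutive z) ⟩
    (x ∧ ¬ y) ∧ z     ≈⟨ ∧-swapʳ x (¬ y) z ⟩
    (x ∧ z) ∧ ¬ y     ≈⟨ x≤y⇒x∧¬y≈⊥ x∧z≤y ⟩
    ⊥                 ∎)

  module MeetPreserving (□ : Op₁ Carrier) (□-cong : Congruent₁ _≈_ □)
                        (□-∧ : ∀ x y → □ (x ∧ y) ≈ □ x ∧ □ y)
                        (◇ : Op₁ Carrier) (◇≈¬□¬ : ∀ x → ◇ x ≈ ¬ □ (¬ x)) where

    □-mono : ∀ {x y} → x ≤ y → □ x ≤ □ y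
    □-mono {x} {y} x≤y = trans (sym (□-∧ x y)) (□-cong x≤y)

    □-∧-≤ : ∀ {x y z} → x ∧ y ≤ z → □ x ∧ □ y ≤ □ z
    □-∧-≤ {x} {y} x∧y≤z = ≤-respˡ-≈ (□-∧ x y) (□-mono x∧y≤z)

    □-∨-≤ : ∀ x y → □ (x ∨ y) ≤ □ x ∨ ◇ y
    □-∨-≤ x y = ≤-respʳ-≈ (∨-congˡ (sym (◇≈¬□¬ y))) (∧-≤⇒≤-∨¬ (□-∧-≤ (x∧¬y≈⊥⇒x≤y (begin
      ((x ∨ y) ∧ ¬ y) ∧ ¬ x ≈⟨ ∧-assoc (x ∨ y) (¬ y) (¬ x) ⟩
      (x ∨ y) ∧ (¬ y ∧ ¬ x) ≈⟨ ∧-congˡ (∧-comm (¬ y) (¬ x)) ⟩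
      (x ∨ y) ∧ (¬ x ∧ ¬ y) ≈⟨ ∧-congˡ (deMorgan₂ x y) ⟨
      (x ∨ y) ∧ ¬ (x ∨ y)   ≈⟨ ∧-complementʳ (x ∨ y) ⟩
      ⊥                     ∎))))

    ◇-⊥ : □ ⊤ ≈ ⊤ → ◇ ⊥ ≈ ⊥
    ◇-⊥ □⊤≈⊤ = begin
      ◇ ⊥       ≈⟨ ◇≈¬□¬ ⊥ ⟩
      ¬ □ (¬ ⊥) ≈⟨ ¬-cong (□-cong ¬⊥≈⊤) ⟩
      ¬ □ ⊤     ≈⟨ ¬-cong □⊤≈⊤ ⟩
      ¬ ⊤       ≈⟨ ¬⊤≈⊥ ⟩
      ⊥         ∎

    ◇-∨ : ∀ x y → ◇ (x ∨ y) ≈ ◇ x ∨ ◇ y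
    ◇-∨ x y = begin
      ◇ (x ∨ y)             ≈⟨ ◇≈¬□¬ (x ∨ y) ⟩
      ¬ □ (¬ (x ∨ y))       ≈⟨ ¬-cong (□-cong (deMorgan₂ x y)) ⟩
      ¬ □ (¬ x ∧ ¬ y)       ≈⟨ ¬-cong (□-∧ (¬ x) (¬ y)) ⟩
      ¬ (□ (¬ x) ∧ □ (¬ y)) ≈⟨ deMorgan₁ (□ (¬ x)) (□ (¬ y)) ⟩
      ¬ □ (¬ x) ∨ ¬ □ (¬ y) ≈⟨ ∨-cong (◇≈¬□¬ x) (◇≈¬□¬ y) ⟨
      ◇ x ∨ ◇ y             ∎

    □-∧-◇-≤ : ∀ x y → □ x ∧ ◇ y ≤ ◇ (x ∧ y)
    □-∧-◇-≤ x y = ≤-respˡ-≈ (∧-congˡ (sym (◇≈¬□¬ y))) (≤-respʳ-≈ (sym (◇≈¬□¬ (x ∧ y)))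
      (∧-≤⇒∧¬-≤¬ (□-∧-≤ (x∧¬y≈⊥⇒x≤y (begin
        (x ∧ ¬ (x ∧ y)) ∧ ¬ ¬ y ≈⟨ ∧-swapʳ x (¬ (x ∧ y)) (¬ ¬ y) ⟩
        (x ∧ ¬ ¬ y) ∧ ¬ (x ∧ y) ≈⟨ ∧-congʳ (∧-congˡ (¬-involutive y)) ⟩
        (x ∧ y) ∧ ¬ (x ∧ y)     ≈⟨ ∧-complementʳ (x ∧ y) ⟩
        ⊥                       ∎)))))

    -- (t3) for a second pair □′, ◇′ = ¬□′¬ yields (t7) for ◇′ □, by contraposition at ¬x.
    ◇′□-≤ : (□′ ◇′ : Op₁ Carrier) → Congruent₁ _≈_ □′ → (∀ x → ◇′ x ≈ ¬ □′ (¬ x)) →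
            (∀ x → x ≤ □′ (◇ x)) → ∀ x → ◇′ (□ x) ≤ x
    ◇′□-≤ □′ ◇′ □′-cong ◇′≈¬□′¬ x≤□′◇x x =
      ≤-respʳ-≈ (¬-involutive x) (≤-respˡ-≈ ¬□′◇¬x≈◇′□x (¬-antitone (x≤□′◇x (¬ x))))
      where
      ¬□′◇¬x≈◇′□x : ¬ □′ (◇ (¬ x)) ≈ ◇′ (□ x)
      ¬□′◇¬x≈◇′□x = begin
        ¬ □′ (◇ (¬ x))      ≈⟨ ¬-cong (□′-cong (◇≈¬□¬ (¬ x))) ⟩
        ¬ □′ (¬ □ (¬ ¬ x))  ≈⟨ ¬-cong (□′-cong (¬-cong (□-cong (¬-involutive x)))) ⟩
        ¬ □′ (¬ □ x)        ≈⟨ ◇′≈¬□′¬ (□ x) ⟨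
        ◇′ (□ x)            ∎

  ◇≈¬□¬ : (□ ◇ : Op₁ Carrier) → Congruent₁ _≈_ □ → Congruent₁ _≈_ ◇ → □ ⊤ ≈ ⊤ → ◇ ⊥ ≈ ⊥ →
          (∀ x y → □ (x ∨ y) ≤ □ x ∨ ◇ y) → (∀ x y → □ x ∧ ◇ y ≤ ◇ (x ∧ y)) →
          ∀ x → ◇ x ≈ ¬ □ (¬ x)
  ◇≈¬□¬ □ ◇ □-cong ◇-cong □⊤≈⊤ ◇⊥≈⊥ □-∨-≤ □-∧-◇-≤ x = sym (¬-unique
    (x≤⊥⇒x≈⊥ (≤-respʳ-≈ (trans (◇-cong (∧-complementˡ x)) ◇⊥≈⊥) (□-∧-◇-≤ (¬ x) x)))
    (⊤≤x⇒x≈⊤ (≤-respˡ-≈ (trans (□-cong (∨-complementˡ x)) □⊤≈⊤) (□-∨-≤ (¬ x) x))))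

  module _ (O : Operators B) where
    open Operators O

    isTense⇒isTDL : IsTense B O → IsTDL B O
    isTense⇒isTDL T = record
      { t1G = t1G ; t1H = t1H ; t2G = t2G ; t2H = t2H ; t3G = t3G ; t3H = t3H
      ; t4G = GF.□-∨-≤ ; t4H = HP.□-∨-≤
      ; t5F = GF.◇-⊥ t1G ; t5P = HP.◇-⊥ t1H
      ; t6F = GF.◇-∨ ; t6P = HP.◇-∨
      ; t7G = GF.◇′□-≤ H P H-cong P-def t3H
      ; t7H = HP.◇′□-≤ G F G-cong F-def t3G
      ; t8F = GF.□-∧-◇-≤ ; t8P = HP.□-∧-◇-≤
      }
      where
      open IsTense T
      module GF = MeetPreserving G G-cong t2G F F-def
      module HP = MeetPreserving H H-cong t2H P P-def

    isTDL⇒isTense : IsTDL B O → IsTense B O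
    isTDL⇒isTense D = record
      { t1G = t1G ; t1H = t1H ; t2G = t2G ; t2H = t2H ; t3G = t3G ; t3H = t3H
      ; F-def = ◇≈¬□¬ G F G-cong F-cong t1G t5F t4G t8F
      ; P-def = ◇≈¬□¬ H P H-cong P-cong t1H t5P t4H t8P
      }
      where open IsTDL D

theorem2p16 : {c ℓ : Level} (B : BooleanAlgebra c ℓ) (O : Operators B) →
    (IsTense B O → IsTDL B O) × (IsTDL B O → IsTense B O)
theorem2p16 B O = isTense⇒isTDL B O , isTDL⇒isTense B O
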